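{- Let $M=(E,\rho)$ be a matroid and $Y\subseteq E$ a subset of full rank, i.e. $\rho(Y)=\rho(E)$. Let $k=\rho(Y)$ and $n=|Y|$. Then $M|Y$ is isomorphic to the uniform matroid $U_n^k$ if and only if either $Y$ is a basis of $M$, or the following two conditions are satisfied: (1) $Y$ is a cyclic set of $M$; (2) for all $Z\in\mathcal{Z}(M)$ with $\rho(Z)<k$, the set $Z\cap Y$ is independent in $M$.
   Context: A matroid $M=(E,\rho)$ is given by its rank function. The cyclic operator is $\mathrm{cyc}(X)=\{e\in X:\rho(X-e)=\rho(X)\}$, the closure operator is $\mathrm{cl}(X)=\{e\in E:\rho(X\cup e)=\rho(X)\}$. A set $X$ is cyclic if $\mathrm{cyc}(X)=X$, a flat if $\mathrm{cl}(X)=X$, and a cyclic flat if both; $\mathcal{Z}(M)$ is the set of cyclic flats. $M|Y$ is the restriction of $M$ to $Y$. $U_n^k$ is the uniform matroid on $n$ elements with rank function $A\mapsto\min\{|A|,k\}$. -}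

module Defs where

open import Data.Nat using (ℕ; zero; suc; _+_; _≤_; _<_; _⊓_)
open import Data.Bool using (Bool; true; false; _∧_; _∨_)
open import Data.Fin using (Fin; zero; suc; _≟_)
open import Data.Fin.Subset using (Subset; ⊤; ⁅_⁆; _∈_; _∉_; _⊆_; _∩_; _∪_; _-_; ∣_∣)
open import Data.Vec using (lookup; tabulate)
open import Data.Product using (_×_)
open import Relation.Nullary using (¬_)
open import Relation.Nullary.Decidable using (⌊_⌋)
open import Relation.Binary.PropositionalEquality using (_≡_)
open import Function.Definitions using (Injective)

record Matroid (m : ℕ) : Set where
  field
    ρ       : Subset m → ℕ
    ρ-bound : ∀ X → ρ X ≤ ∣ X ∣
    ρ-mono  : ∀ {X Y} → X ⊆ Y → ρ X ≤ ρ Y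
    ρ-submod : ∀ X Y → ρ (X ∪ Y) + ρ (X ∩ Y) ≤ ρ X + ρ Y

module _ {m : ℕ} (M : Matroid m) where
  open Matroid M

  Independent : Subset m → Set
  Independent X = ρ X ≡ ∣ X ∣

  Basis : Subset m → Set
  Basis X = Independent X × (∀ e → e ∉ X → ¬ Independent (X ∪ ⁅ e ⁆))

  -- cyclic: cyc(X) = X, i.e. every e ∈ X has ρ(X - e) = ρ(X)
  Cyclic : Subset m → Set
  Cyclic X = ∀ e → e ∈ X → ρ (X - e) ≡ ρ X

  -- flat: cl(X) = X, i.e. ρ(X ∪ e) = ρ(X) implies e ∈ X
  Flat : Subset m → Set
  Flat X = ∀ e → ρ (X ∪ ⁅ e ⁆) ≡ ρ X → e ∈ X

  CyclicFlat : Subset m → Set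
  CyclicFlat X = Cyclic X × Flat X

anyFin : ∀ {n} → (Fin n → Bool) → Bool
anyFin {zero}  p = false
anyFin {suc n} p = p zero ∨ anyFin (λ i → p (suc i))

image : ∀ {n m} → (Fin n → Fin m) → Subset n → Subset m
image φ A = tabulate (λ e → anyFin (λ i → lookup A i ∧ ⌊ φ i ≟ e ⌋))

uniformRank : (n k : ℕ) → Subset n → ℕ
uniformRank n k A = ∣ A ∣ ⊓ k

-- M|Y ≅ N, where N is a matroid (rank function) on Fin n:
-- a bijection φ : Fin n → Y (injective map into E with image Y)
-- such that ρ_{M|Y}(φ A) = ρ_N(A) for every A ⊆ Fin n.
-- (Every subset of Y is φ A for a unique A.)
RestrictionIso : ∀ {m} → Matroid m → Subset m → (n : ℕ) → (Subset n → ℕ) → Set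
RestrictionIso M Y n ρN =
  Σ (Fin n → Fin _) λ φ →
    Injective _≡_ _≡_ φ × image φ ⊤ ≡ Y × (∀ A → Matroid.ρ M (image φ A) ≡ ρN A)
  where open import Data.Product using (Σ)

-- Both sides are compared with the condition ρ X = min(|X|, ρ Y) for all X ⊆ Y, which is
-- M|Y ≅ U_n^k read through an enumeration of Y. It holds trivially when Y is independent.
-- Otherwise ρ Y < |Y| and it says exactly that Y is cyclic and every X ⊆ Y with ρ X < ρ Y is
-- independent. That last property follows from (2): a dependent such X has a closure F of the
-- same rank with F ∩ Y dependent, and deleting coloops of F one at a time keeps F a flat whose
-- trace on Y is dependent, ending in a cyclic flat of rank < ρ Y that violates (2).

module Submission where

open import Defs
open import Data.Nat using (ℕ; zero; suc; _+_; _≤_; _<_; _⊓_; _≟_; _<?_)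
open import Data.Nat.Properties hiding (suc-injective)
open import Data.Nat.Induction using (<-wellFounded)
open import Data.Bool using (Bool; true; false; T)
open import Data.Bool.Properties using (T-∧; T-≡)
open import Data.Fin using (Fin; zero; suc) renaming (_≟_ to _≟ᶠ_)
open import Data.Fin.Properties using (¬Fin0; any?; suc-injective)
open import Data.Fin.Subset
open import Data.Fin.Subset.Properties
open import Data.Vec using ([]; _∷_; here; there; lookup; tabulate)
open import Data.Vec.Properties using ([]=⇒lookup; lookup⇒[]=; lookup∘tabulate)
open import Data.Product using (Σ-syntax; ∃-syntax; _×_; _,_; proj₁; proj₂)
open import Data.Sum using (_⊎_; inj₁; inj₂)
open import Function using (_∘_; _on_)
open import Function.Bundles using (_⇔_; mk⇔; Equivalence)
open import Function.Construct.Composition using (_⇔-∘_)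
open import Function.Definitions using (Injective)
open import Induction.WellFounded using (Acc; acc)
import Relation.Binary.Construct.On as On
open import Relation.Nullary using (¬_; yes; no; contradiction)
open import Relation.Nullary.Decidable using (toWitness; fromWitness; decidable-stable; ¬?; _×-dec_)
open import Relation.Binary.PropositionalEquality

∣⁅x⁆∪p∣≡1+∣p∣ : ∀ {n} {x : Fin n} {p : Subset n} → x ∉ p → ∣ ⁅ x ⁆ ∪ p ∣ ≡ suc ∣ p ∣
∣⁅x⁆∪p∣≡1+∣p∣ {x = zero}  {false ∷ p} _   = cong (suc ∘ ∣_∣) (∪-identityˡ p)
∣⁅x⁆∪p∣≡1+∣p∣ {x = zero}  {true ∷ p}  x∉p = contradiction here x∉p
∣⁅x⁆∪p∣≡1+∣p∣ {x = suc x} {false ∷ p} x∉p = ∣⁅x⁆∪p∣≡1+∣p∣ (x∉p ∘ there)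
∣⁅x⁆∪p∣≡1+∣p∣ {x = suc x} {true ∷ p}  x∉p = cong suc (∣⁅x⁆∪p∣≡1+∣p∣ (x∉p ∘ there))

x∈p⇒1+∣p-x∣≡∣p∣ : ∀ {n} {x : Fin n} {p : Subset n} → x ∈ p → suc ∣ p - x ∣ ≡ ∣ p ∣
x∈p⇒1+∣p-x∣≡∣p∣ {x = zero}  {true ∷ p}  here        = cong (suc ∘ ∣_∣) (p─⊥≡p p)
x∈p⇒1+∣p-x∣≡∣p∣ {x = suc x} {false ∷ p} (there x∈p) = x∈p⇒1+∣p-x∣≡∣p∣ x∈p
x∈p⇒1+∣p-x∣≡∣p∣ {x = suc x} {true ∷ p}  (there x∈p) = cong suc (x∈p⇒1+∣p-x∣≡∣p∣ x∈p)

x∉p⇒p-x≡p : ∀ {n} {x : Fin n} {p : Subset n} → x ∉ p → p - x ≡ p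
x∉p⇒p-x≡p {x = zero}  {false ∷ p} _   = cong (false ∷_) (p─⊥≡p p)
x∉p⇒p-x≡p {x = zero}  {true ∷ p}  x∉p = contradiction here x∉p
x∉p⇒p-x≡p {x = suc x} {b ∷ p}     x∉p = cong (b ∷_) (x∉p⇒p-x≡p (x∉p ∘ there))

x∈p─q⇒x∉q : ∀ {n} {x : Fin n} (p q : Subset n) → x ∈ p ─ q → x ∉ q
x∈p─q⇒x∉q {x = zero}  (true ∷ p)  (false ∷ q) here        = λ ()
x∈p─q⇒x∉q {x = zero}  (false ∷ p) (false ∷ q) ()
x∈p─q⇒x∉q {x = zero}  (_ ∷ p)     (true ∷ q)  ()
x∈p─q⇒x∉q {x = suc x} (_ ∷ p)     (_ ∷ q)     (there x∈p) = x∈p─q⇒x∉q p q x∈p ∘ drop-there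

[p─r]∩q≡[p∩q]─r : ∀ {n} (p q r : Subset n) → (p ─ r) ∩ q ≡ (p ∩ q) ─ r
[p─r]∩q≡[p∩q]─r []      []      []          = refl
[p─r]∩q≡[p∩q]─r (_ ∷ p) (_ ∷ q) (true ∷ r)  = cong (false ∷_) ([p─r]∩q≡[p∩q]─r p q r)
[p─r]∩q≡[p∩q]─r (_ ∷ p) (_ ∷ q) (false ∷ r) = cong (_ ∷_) ([p─r]∩q≡[p∩q]─r p q r)

∣p∣+∣q─p∣≡∣q∣ : ∀ {n} {p q : Subset n} → p ⊆ q → ∣ p ∣ + ∣ q ─ p ∣ ≡ ∣ q ∣
∣p∣+∣q─p∣≡∣q∣ {p = []}        {[]}        _   = refl
∣p∣+∣q─p∣≡∣q∣ {p = true ∷ p}  {true ∷ q}  p⊆q = cong suc (∣p∣+∣q─p∣≡∣q∣ (drop-∷-⊆ p⊆q))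
∣p∣+∣q─p∣≡∣q∣ {p = true ∷ p}  {false ∷ q} p⊆q = contradiction (p⊆q here) λ ()
∣p∣+∣q─p∣≡∣q∣ {p = false ∷ p} {true ∷ q}  p⊆q =
  trans (+-suc ∣ p ∣ _) (cong suc (∣p∣+∣q─p∣≡∣q∣ (drop-∷-⊆ p⊆q)))
∣p∣+∣q─p∣≡∣q∣ {p = false ∷ p} {false ∷ q} p⊆q = ∣p∣+∣q─p∣≡∣q∣ (drop-∷-⊆ p⊆q)

q⊆p∪[q─p] : ∀ {n} (p q : Subset n) → q ⊆ p ∪ (q ─ p)
q⊆p∪[q─p] p q {x} x∈q with x ∈? p
... | yes x∈p = x∈p∪q⁺ (inj₁ x∈p)
... | no  x∉p = x∈p∪q⁺ (inj₂ (x∈p∧x∉q⇒x∈p─q x∈q x∉p))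

x∈q⇒p⊆[p-x]∪q : ∀ {n} {x : Fin n} {q : Subset n} p → x ∈ q → p ⊆ (p - x) ∪ q
x∈q⇒p⊆[p-x]∪q {x = x} p x∈q {y} y∈p with y ≟ᶠ x
... | yes refl = x∈p∪q⁺ (inj₂ x∈q)
... | no  y≢x  = x∈p∪q⁺ (inj₁ (x∈p∧x≢y⇒x∈p-y y∈p y≢x))

x∉p⇒p⊂p∪⁅x⁆ : ∀ {n} {x : Fin n} {p : Subset n} → x ∉ p → p ⊂ p ∪ ⁅ x ⁆
x∉p⇒p⊂p∪⁅x⁆ {x = x} x∉p = p⊆p∪q ⁅ x ⁆ , x , x∈p∪q⁺ (inj₂ (x∈⁅x⁆ x)) , x∉p

anyFin⁻ : ∀ {n} (p : Fin n → Bool) → T (anyFin p) → ∃[ i ] T (p i)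
anyFin⁻ {suc n} p hit with p zero in p0
... | true  = zero , subst T (sym p0) _
... | false = let i , pi = anyFin⁻ (p ∘ suc) hit in suc i , pi

anyFin⁺ : ∀ {n} (p : Fin n → Bool) i → T (p i) → T (anyFin p)
anyFin⁺ p zero    pi with p zero
... | true = _
anyFin⁺ p (suc i) pi with p zero
... | true  = _
... | false = anyFin⁺ (p ∘ suc) i pi

∈⇒T-lookup : ∀ {n} {x : Fin n} {p : Subset n} → x ∈ p → T (lookup p x)
∈⇒T-lookup = Equivalence.from T-≡ ∘ []=⇒lookup

T-lookup⇒∈ : ∀ {n} {x : Fin n} (p : Subset n) → T (lookup p x) → x ∈ p
T-lookup⇒∈ p = lookup⇒[]= _ p ∘ Equivalence.to T-≡

preimage : ∀ {n m} → (Fin n → Fin m) → Subset m → Subset n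
preimage φ X = tabulate (λ i → lookup X (φ i))

module _ {n m : ℕ} (φ : Fin n → Fin m) where

  ∈-image⁻ : ∀ A {e} → e ∈ image φ A → ∃[ i ] i ∈ A × φ i ≡ e
  ∈-image⁻ A {e} e∈φA =
    let i , hit = anyFin⁻ _ (subst T (lookup∘tabulate _ e) (∈⇒T-lookup e∈φA))
        i∈A , φi≡e = Equivalence.to T-∧ hit
    in i , T-lookup⇒∈ A i∈A , toWitness φi≡e

  ∈-image⁺ : ∀ {A i} → i ∈ A → φ i ∈ image φ A
  ∈-image⁺ {A} {i} i∈A = T-lookup⇒∈ (image φ A) (subst T (sym (lookup∘tabulate _ (φ i)))
    (anyFin⁺ _ i (Equivalence.from T-∧ (∈⇒T-lookup i∈A , fromWitness refl))))

  ∈-preimage⁻ : ∀ X {i} → i ∈ preimage φ X → φ i ∈ X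
  ∈-preimage⁻ X {i} = T-lookup⇒∈ X ∘ subst T (lookup∘tabulate _ i) ∘ ∈⇒T-lookup

  ∈-preimage⁺ : ∀ {X i} → φ i ∈ X → i ∈ preimage φ X
  ∈-preimage⁺ {X} {i} = T-lookup⇒∈ (preimage φ X) ∘ subst T (sym (lookup∘tabulate _ i)) ∘ ∈⇒T-lookup

  image⊆range : ∀ A → image φ A ⊆ image φ ⊤
  image⊆range A e∈φA with ∈-image⁻ A e∈φA
  ... | i , _ , refl = ∈-image⁺ ∈⊤

  image-preimage : ∀ {X} → X ⊆ image φ ⊤ → image φ (preimage φ X) ≡ X
  image-preimage {X} X⊆range = ⊆-antisym ⊆X X⊆
    where
    ⊆X : image φ (preimage φ X) ⊆ X
    ⊆X e∈ with ∈-image⁻ (preimage φ X) e∈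
    ... | i , i∈ , refl = ∈-preimage⁻ X i∈
    X⊆ : X ⊆ image φ (preimage φ X)
    X⊆ e∈X with ∈-image⁻ ⊤ (X⊆range e∈X)
    ... | i , _ , refl = ∈-image⁺ (∈-preimage⁺ e∈X)

image-∷-true : ∀ {n m} (φ : Fin (suc n) → Fin m) A → image φ (true ∷ A) ≡ ⁅ φ zero ⁆ ∪ image (φ ∘ suc) A
image-∷-true φ A = ⊆-antisym ⊆∪ ∪⊆
  where
  ⊆∪ : image φ (true ∷ A) ⊆ ⁅ φ zero ⁆ ∪ image (φ ∘ suc) A
  ⊆∪ e∈ with ∈-image⁻ φ (true ∷ A) e∈
  ... | zero  , _           , refl = x∈p∪q⁺ (inj₁ (x∈⁅x⁆ (φ zero)))
  ... | suc i , there i∈A , refl = x∈p∪q⁺ (inj₂ (∈-image⁺ (φ ∘ suc) i∈A))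
  ∪⊆ : ⁅ φ zero ⁆ ∪ image (φ ∘ suc) A ⊆ image φ (true ∷ A)
  ∪⊆ e∈ with x∈p∪q⁻ ⁅ φ zero ⁆ (image (φ ∘ suc) A) e∈
  ... | inj₁ e∈⁅φ0⁆ rewrite x∈⁅y⁆⇒x≡y (φ zero) e∈⁅φ0⁆ = ∈-image⁺ φ {true ∷ A} here
  ... | inj₂ e∈ψA with ∈-image⁻ (φ ∘ suc) A e∈ψA
  ...   | i , i∈A , refl = ∈-image⁺ φ {true ∷ A} (there i∈A)

∣image∣≡∣∣ : ∀ {n m} (φ : Fin n → Fin m) → Injective _≡_ _≡_ φ → ∀ A → ∣ image φ A ∣ ≡ ∣ A ∣
∣image∣≡∣∣ {zero} {m} φ _ [] =
  trans (cong ∣_∣ (Empty-unique λ (_ , e∈) → ¬Fin0 (proj₁ (∈-image⁻ φ [] e∈)))) (∣⊥∣≡0 m)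
∣image∣≡∣∣ {suc n} φ φ-inj (false ∷ A) = ∣image∣≡∣∣ (φ ∘ suc) (suc-injective ∘ φ-inj) A
∣image∣≡∣∣ {suc n} φ φ-inj (true ∷ A)  = begin
  ∣ image φ (true ∷ A) ∣                   ≡⟨ cong ∣_∣ (image-∷-true φ A) ⟩
  ∣ ⁅ φ zero ⁆ ∪ image (φ ∘ suc) A ∣      ≡⟨ ∣⁅x⁆∪p∣≡1+∣p∣ φ0∉ ⟩
  suc ∣ image (φ ∘ suc) A ∣                ≡⟨ cong suc (∣image∣≡∣∣ (φ ∘ suc) (suc-injective ∘ φ-inj) A) ⟩
  suc ∣ A ∣                                ∎
  where
  open ≡-Reasoning
  φ0∉ : φ zero ∉ image (φ ∘ suc) A
  φ0∉ φ0∈ with ∈-image⁻ (φ ∘ suc) A φ0∈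
  ... | i , _ , φsi≡φ0 with φ-inj φsi≡φ0
  ... | ()

enumerate : ∀ {m} (Y : Subset m) → Fin ∣ Y ∣ → Fin m
enumerate (true ∷ Y)  zero    = zero
enumerate (true ∷ Y)  (suc i) = suc (enumerate Y i)
enumerate (false ∷ Y) i       = suc (enumerate Y i)

enumerate-injective : ∀ {m} (Y : Subset m) → Injective _≡_ _≡_ (enumerate Y)
enumerate-injective (true ∷ Y)  {zero}  {zero}  _  = refl
enumerate-injective (true ∷ Y)  {suc i} {suc j} eq = cong suc (enumerate-injective Y (suc-injective eq))
enumerate-injective (false ∷ Y)                 eq = enumerate-injective Y (suc-injective eq)

enumerate-∈ : ∀ {m} (Y : Subset m) i → enumerate Y i ∈ Y
enumerate-∈ (true ∷ Y)  zero    = here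
enumerate-∈ (true ∷ Y)  (suc i) = there (enumerate-∈ Y i)
enumerate-∈ (false ∷ Y) i       = there (enumerate-∈ Y i)

enumerate-surjective : ∀ {m} (Y : Subset m) {e} → e ∈ Y → ∃[ i ] enumerate Y i ≡ e
enumerate-surjective (true ∷ Y)  here        = zero , refl
enumerate-surjective (true ∷ Y)  (there e∈Y) = let i , eq = enumerate-surjective Y e∈Y in suc i , cong suc eq
enumerate-surjective (false ∷ Y) (there e∈Y) = let i , eq = enumerate-surjective Y e∈Y in i , cong suc eq

range-enumerate : ∀ {m} (Y : Subset m) → image (enumerate Y) ⊤ ≡ Y
range-enumerate Y = ⊆-antisym range⊆Y Y⊆range
  where
  range⊆Y : image (enumerate Y) ⊤ ⊆ Y
  range⊆Y e∈ with ∈-image⁻ (enumerate Y) ⊤ e∈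
  ... | i , _ , refl = enumerate-∈ Y i
  Y⊆range : Y ⊆ image (enumerate Y) ⊤
  Y⊆range e∈Y with enumerate-surjective Y e∈Y
  ... | i , refl = ∈-image⁺ (enumerate Y) ∈⊤

module _ {m : ℕ} (M : Matroid m) where
  open Matroid M
  open ≤-Reasoning

  ρ-submod-⊆ : ∀ {A B C D} → C ⊆ A ∪ B → D ⊆ A ∩ B → ρ C + ρ D ≤ ρ A + ρ B
  ρ-submod-⊆ {A} {B} C⊆A∪B D⊆A∩B = ≤-trans (+-mono-≤ (ρ-mono C⊆A∪B) (ρ-mono D⊆A∩B)) (ρ-submod A B)

  ρ-∪-≤ : ∀ A B → ρ (A ∪ B) ≤ ρ A + ∣ B ∣
  ρ-∪-≤ A B = begin
    ρ (A ∪ B)               ≤⟨ m≤m+n _ _ ⟩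
    ρ (A ∪ B) + ρ (A ∩ B)   ≤⟨ ρ-submod A B ⟩
    ρ A + ρ B               ≤⟨ +-monoʳ-≤ (ρ A) (ρ-bound B) ⟩
    ρ A + ∣ B ∣             ∎

  independent-⊆ : ∀ {A B} → A ⊆ B → Independent M B → Independent M A
  independent-⊆ {A} {B} A⊆B B-indep = ≤-antisym (ρ-bound A) (+-cancelʳ-≤ ∣ B ─ A ∣ _ _ (begin
    ∣ A ∣ + ∣ B ─ A ∣   ≡⟨ ∣p∣+∣q─p∣≡∣q∣ A⊆B ⟩
    ∣ B ∣               ≡⟨ B-indep ⟨
    ρ B                 ≤⟨ ρ-mono (q⊆p∪[q─p] A B) ⟩
    ρ (A ∪ (B ─ A))     ≤⟨ ρ-∪-≤ A (B ─ A) ⟩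
    ρ A + ∣ B ─ A ∣     ∎))

  independent-fullRank⇒basis : ∀ {B} → ρ B ≡ ρ ⊤ → Independent M B → Basis M B
  independent-fullRank⇒basis {B} full B-indep = B-indep , λ e e∉B B+e-indep →
    <-irrefl refl (begin-strict
      ρ ⊤               ≡⟨ full ⟨
      ρ B               ≡⟨ B-indep ⟩
      ∣ B ∣             <⟨ p⊂q⇒∣p∣<∣q∣ (x∉p⇒p⊂p∪⁅x⁆ e∉B) ⟩
      ∣ B ∪ ⁅ e ⁆ ∣     ≡⟨ B+e-indep ⟨
      ρ (B ∪ ⁅ e ⁆)     ≤⟨ ρ-mono ⊆⊤ ⟩
      ρ ⊤               ∎)

  closure-mono : ∀ {A B} C → A ⊆ B → ρ (A ∪ C) ≡ ρ A → ρ (B ∪ C) ≡ ρ B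
  closure-mono {A} {B} C A⊆B ρ[A∪C]≡ρA = ≤-antisym
    (+-cancelʳ-≤ (ρ A) _ _ (begin
      ρ (B ∪ C) + ρ A     ≤⟨ ρ-submod-⊆ B∪C⊆ A⊆ ⟩
      ρ B + ρ (A ∪ C)     ≡⟨ cong (ρ B +_) ρ[A∪C]≡ρA ⟩
      ρ B + ρ A           ∎))
    (ρ-mono (p⊆p∪q C))
    where
    B∪C⊆ : B ∪ C ⊆ B ∪ (A ∪ C)
    B∪C⊆ x∈B∪C with x∈p∪q⁻ B C x∈B∪C
    ... | inj₁ x∈B = x∈p∪q⁺ (inj₁ x∈B)
    ... | inj₂ x∈C = x∈p∪q⁺ (inj₂ (q⊆p∪q A C x∈C))
    A⊆ : A ⊆ B ∩ (A ∪ C)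
    A⊆ x∈A = x∈p∩q⁺ (A⊆B x∈A , p⊆p∪q C x∈A)

  coloop-⊆ : ∀ {S F e} → S ⊆ F → e ∈ S → ρ (F - e) < ρ F → ρ (S - e) < ρ S
  coloop-⊆ {S} {F} {e} S⊆F e∈S coloop = ≰⇒> λ ρS≤ρ[S-e] → <⇒≱ coloop
    (+-cancelʳ-≤ (ρ (S - e)) _ _ (begin
      ρ F + ρ (S - e)         ≤⟨ ρ-submod-⊆ (x∈q⇒p⊆[p-x]∪q F e∈S) S-e⊆ ⟩
      ρ (F - e) + ρ S         ≤⟨ +-monoʳ-≤ (ρ (F - e)) ρS≤ρ[S-e] ⟩
      ρ (F - e) + ρ (S - e)   ∎))
    where
    S-e⊆ : S - e ⊆ (F - e) ∩ S
    S-e⊆ x∈S-e = x∈p∩q⁺ (x∈p∧x∉q⇒x∈p─q (S⊆F x∈S) (x∈p─q⇒x∉q S ⁅ e ⁆ x∈S-e) , x∈S)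
      where x∈S = p─q⊆p S ⁅ e ⁆ x∈S-e

  coloop-independent : ∀ {S e} → e ∈ S → ρ (S - e) < ρ S → Independent M (S - e) → Independent M S
  coloop-independent {S} {e} e∈S coloop S-e-indep = ≤-antisym (ρ-bound S) (begin
    ∣ S ∣             ≡⟨ x∈p⇒1+∣p-x∣≡∣p∣ e∈S ⟨
    suc ∣ S - e ∣     ≡⟨ cong suc S-e-indep ⟨
    suc (ρ (S - e))   ≤⟨ coloop ⟩
    ρ S               ∎)

  flat-removeColoop : ∀ {F e} → Flat M F → e ∈ F → ρ (F - e) < ρ F → Flat M (F - e)
  flat-removeColoop {F} {e} F-flat e∈F coloop f ρ[F-e+f]≡ρ[F-e] with f ≟ᶠ e
  ... | yes refl = contradiction
          (≤-trans (ρ-mono (x∈q⇒p⊆[p-x]∪q F (x∈⁅x⁆ e))) (≤-reflexive ρ[F-e+f]≡ρ[F-e]))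
          (<⇒≱ coloop)
  ... | no f≢e = x∈p∧x≢y⇒x∈p-y (F-flat f (closure-mono ⁅ f ⁆ (p─q⊆p F ⁅ e ⁆) ρ[F-e+f]≡ρ[F-e])) f≢e

  dependent-removeColoop : ∀ {F e} Y → e ∈ F → ρ (F - e) < ρ F →
                           ¬ Independent M (F ∩ Y) → ¬ Independent M ((F - e) ∩ Y)
  dependent-removeColoop {F} {e} Y e∈F coloop F∩Y-dep
    rewrite [p─r]∩q≡[p∩q]─r F Y ⁅ e ⁆ with e ∈? Y
  ... | yes e∈Y = F∩Y-dep ∘ coloop-independent e∈F∩Y (coloop-⊆ (p∩q⊆p F Y) e∈F∩Y coloop)
    where e∈F∩Y = x∈p∩q⁺ (e∈F , e∈Y)
  ... | no e∉Y = subst (¬_ ∘ Independent M) (sym (x∉p⇒p-x≡p (e∉Y ∘ proj₂ ∘ x∈p∩q⁻ F Y))) F∩Y-dep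

  flat⊎extendable : ∀ X → Flat M X ⊎ ∃[ e ] e ∉ X × ρ (X ∪ ⁅ e ⁆) ≡ ρ X
  flat⊎extendable X with any? (λ e → ¬? (e ∈? X) ×-dec (ρ (X ∪ ⁅ e ⁆) ≟ ρ X))
  ... | yes extendable = inj₂ extendable
  ... | no ¬extendable = inj₁ λ e eq → decidable-stable (e ∈? X) (λ e∉X → ¬extendable (e , e∉X , eq))

  cyclic⊎coloop : ∀ X → Cyclic M X ⊎ ∃[ e ] e ∈ X × ρ (X - e) < ρ X
  cyclic⊎coloop X with any? (λ e → (e ∈? X) ×-dec (ρ (X - e) <? ρ X))
  ... | yes coloop = inj₂ coloop
  ... | no ¬coloop = inj₁ λ e e∈X →
          ≤-antisym (ρ-mono (p─q⊆p X ⁅ e ⁆)) (≮⇒≥ λ lt → ¬coloop (e , e∈X , lt))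

  flatHull : ∀ X → Σ[ F ∈ Subset m ] X ⊆ F × ρ F ≡ ρ X × Flat M F
  flatHull X = go X (On.wellFounded (∣_∣ ∘ ∁) <-wellFounded X)
    where
    go : ∀ X → Acc (_<_ on (∣_∣ ∘ ∁)) X → Σ[ F ∈ Subset m ] X ⊆ F × ρ F ≡ ρ X × Flat M F
    go X (acc rec) with flat⊎extendable X
    ... | inj₁ X-flat = X , ⊆-refl , refl , X-flat
    ... | inj₂ (e , e∉X , ρ[X+e]≡ρX)
      with go (X ∪ ⁅ e ⁆) (rec (p⊂q⇒∣p∣<∣q∣ (p⊂q⇒∁p⊃∁q (x∉p⇒p⊂p∪⁅x⁆ e∉X))))
    ...   | F , X+e⊆F , ρF≡ , F-flat = F , X+e⊆F ∘ p⊆p∪q ⁅ e ⁆ , trans ρF≡ ρ[X+e]≡ρX , F-flat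

  cyclicFlatInside : ∀ Y F → Flat M F → ¬ Independent M (F ∩ Y) →
                     Σ[ Z ∈ Subset m ] Z ⊆ F × CyclicFlat M Z × ¬ Independent M (Z ∩ Y)
  cyclicFlatInside Y F = go F (On.wellFounded ∣_∣ <-wellFounded F)
    where
    go : ∀ F → Acc (_<_ on ∣_∣) F → Flat M F → ¬ Independent M (F ∩ Y) →
         Σ[ Z ∈ Subset m ] Z ⊆ F × CyclicFlat M Z × ¬ Independent M (Z ∩ Y)
    go F (acc rec) F-flat F∩Y-dep with cyclic⊎coloop F
    ... | inj₁ F-cyclic = F , ⊆-refl , (F-cyclic , F-flat) , F∩Y-dep
    ... | inj₂ (e , e∈F , coloop)
      with go (F - e) (rec (x∈p⇒∣p-x∣<∣p∣ e∈F)) (flat-removeColoop F-flat e∈F coloop)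
              (dependent-removeColoop Y e∈F coloop F∩Y-dep)
    ...   | Z , Z⊆F-e , Z-cyclicFlat , Z∩Y-dep = Z , p─q⊆p F ⁅ e ⁆ ∘ Z⊆F-e , Z-cyclicFlat , Z∩Y-dep

  RankBySize : Subset m → (ℕ → ℕ) → Set
  RankBySize Y f = ∀ X → X ⊆ Y → ρ X ≡ f ∣ X ∣

  UniformOn : Subset m → ℕ → Set
  UniformOn Y k = RankBySize Y (_⊓ k)

  LowCyclicFlatsMeetIndependently : Subset m → Set
  LowCyclicFlatsMeetIndependently Y =
    ∀ Z → CyclicFlat M Z → ρ Z < ρ Y → Independent M (Z ∩ Y)

  independent⇒uniform : ∀ {Y} → Independent M Y → UniformOn Y (ρ Y)
  independent⇒uniform {Y} Y-indep X X⊆Y = trans (independent-⊆ X⊆Y Y-indep)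
    (sym (m≤n⇒m⊓n≡m (≤-trans (p⊆q⇒∣p∣≤∣q∣ X⊆Y) (≤-reflexive (sym Y-indep)))))

  uniform⇒independent : ∀ {Y k X} → UniformOn Y k → X ⊆ Y → ρ X < k → Independent M X
  uniform⇒independent {X = X} uniform X⊆Y ρX<k with ⊓-sel ∣ X ∣ _
  ... | inj₁ ∣X∣⊓k≡∣X∣ = trans (uniform X X⊆Y) ∣X∣⊓k≡∣X∣
  ... | inj₂ ∣X∣⊓k≡k   = contradiction (trans (uniform X X⊆Y) ∣X∣⊓k≡k) (<⇒≢ ρX<k)

  uniform⇒cyclic : ∀ {Y k} → UniformOn Y k → k < ∣ Y ∣ → Cyclic M Y
  uniform⇒cyclic {Y} {k} uniform k<∣Y∣ e e∈Y = begin-equality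
    ρ (Y - e)         ≡⟨ uniform (Y - e) (p─q⊆p Y ⁅ e ⁆) ⟩
    ∣ Y - e ∣ ⊓ k     ≡⟨ m≥n⇒m⊓n≡n (≤-pred (≤-trans k<∣Y∣ (≤-reflexive (sym (x∈p⇒1+∣p-x∣≡∣p∣ e∈Y))))) ⟩
    k                 ≡⟨ m≥n⇒m⊓n≡n (<⇒≤ k<∣Y∣) ⟨
    ∣ Y ∣ ⊓ k         ≡⟨ uniform Y ⊆-refl ⟨
    ρ Y               ∎

  lowCyclicFlats⇒independent : ∀ {Y X} → LowCyclicFlatsMeetIndependently Y →
                               X ⊆ Y → ρ X < ρ Y → Independent M X
  lowCyclicFlats⇒independent {Y} {X} low X⊆Y ρX<ρY = decidable-stable (ρ X ≟ ∣ X ∣) λ X-dep →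
    let F , X⊆F , ρF≡ρX , F-flat = flatHull X
        F∩Y-dep = X-dep ∘ independent-⊆ (λ x∈X → x∈p∩q⁺ (X⊆F x∈X , X⊆Y x∈X))
        Z , Z⊆F , Z-cyclicFlat , Z∩Y-dep = cyclicFlatInside Y F F-flat F∩Y-dep
    in Z∩Y-dep (low Z Z-cyclicFlat (≤-<-trans (ρ-mono Z⊆F) (subst (_< ρ Y) (sym ρF≡ρX) ρX<ρY)))

  lowCyclicFlats⇒uniform : ∀ {Y} → LowCyclicFlatsMeetIndependently Y → UniformOn Y (ρ Y)
  lowCyclicFlats⇒uniform {Y} low X X⊆Y with ρ X <? ρ Y
  ... | yes ρX<ρY = trans X-indep (sym (m≤n⇒m⊓n≡m (<⇒≤ (subst (_< ρ Y) X-indep ρX<ρY))))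
    where X-indep = lowCyclicFlats⇒independent low X⊆Y ρX<ρY
  ... | no ρX≮ρY = trans ρX≡ρY (sym (m≥n⇒m⊓n≡n (≤-trans (≤-reflexive (sym ρX≡ρY)) (ρ-bound X))))
    where ρX≡ρY = ≤-antisym (ρ-mono X⊆Y) (≮⇒≥ ρX≮ρY)

  uniform⇔basis⊎[cyclic×lowCyclicFlats] : ∀ {Y} → ρ Y ≡ ρ ⊤ →
    UniformOn Y (ρ Y) ⇔ (Basis M Y ⊎ (Cyclic M Y × LowCyclicFlatsMeetIndependently Y))
  uniform⇔basis⊎[cyclic×lowCyclicFlats] {Y} full = mk⇔ to from
    where
    to : UniformOn Y (ρ Y) → Basis M Y ⊎ (Cyclic M Y × LowCyclicFlatsMeetIndependently Y)
    to uniform with ρ Y ≟ ∣ Y ∣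
    ... | yes Y-indep = inj₁ (independent-fullRank⇒basis full Y-indep)
    ... | no Y-dep = inj₂ (uniform⇒cyclic uniform (≤∧≢⇒< (ρ-bound Y) Y-dep) , λ Z _ ρZ<ρY →
            uniform⇒independent uniform (p∩q⊆q Z Y) (≤-<-trans (ρ-mono (p∩q⊆p Z Y)) ρZ<ρY))
    from : Basis M Y ⊎ (Cyclic M Y × LowCyclicFlatsMeetIndependently Y) → UniformOn Y (ρ Y)
    from (inj₁ (Y-indep , _)) = independent⇒uniform Y-indep
    from (inj₂ (_ , low))     = lowCyclicFlats⇒uniform low

restrictionIso⇔rankBySize : ∀ {m} (M : Matroid m) Y (f : ℕ → ℕ) →
  RestrictionIso M Y ∣ Y ∣ (f ∘ ∣_∣) ⇔ RankBySize M Y f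
restrictionIso⇔rankBySize M Y f = mk⇔ to from
  where
  open Matroid M
  to : RestrictionIso M Y ∣ Y ∣ (f ∘ ∣_∣) → RankBySize M Y f
  to (φ , φ-inj , range≡Y , ρ∘φ) X X⊆Y = begin
    ρ X                             ≡⟨ cong ρ φ[φ⁻¹X]≡X ⟨
    ρ (image φ (preimage φ X))      ≡⟨ ρ∘φ (preimage φ X) ⟩
    f ∣ preimage φ X ∣              ≡⟨ cong f (∣image∣≡∣∣ φ φ-inj (preimage φ X)) ⟨
    f ∣ image φ (preimage φ X) ∣    ≡⟨ cong (f ∘ ∣_∣) φ[φ⁻¹X]≡X ⟩
    f ∣ X ∣                         ∎
    where
    open ≡-Reasoning
    φ[φ⁻¹X]≡X = image-preimage φ (subst (X ⊆_) (sym range≡Y) X⊆Y)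
  from : RankBySize M Y f → RestrictionIso M Y ∣ Y ∣ (f ∘ ∣_∣)
  from rankBySize = φ , enumerate-injective Y , range-enumerate Y , λ A →
    trans (rankBySize (image φ A) (subst (image φ A ⊆_) (range-enumerate Y) (image⊆range φ A)))
          (cong f (∣image∣≡∣∣ φ (enumerate-injective Y) A))
    where φ = enumerate Y

theorem4p1 : ∀ {m} (M : Matroid m) (Y : Subset m) →
    Matroid.ρ M Y ≡ Matroid.ρ M ⊤ →
    RestrictionIso M Y ∣ Y ∣ (uniformRank ∣ Y ∣ (Matroid.ρ M Y)) ⇔
      (Basis M Y ⊎
        (Cyclic M Y ×
         (∀ Z → CyclicFlat M Z → Matroid.ρ M Z < Matroid.ρ M Y → Independent M (Z ∩ Y))))
theorem4p1 M Y full =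
  uniform⇔basis⊎[cyclic×lowCyclicFlats] M full ⇔-∘ restrictionIso⇔rankBySize M Y (_⊓ Matroid.ρ M Y)
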